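{- The diamond graph $K_4-e$ (the complete graph on $4$ vertices with one edge removed) is not isomorphic to $\mathcal{B}_k(G)$ for any finite simple graph $G$ and positive integer $k$.
   Context: A stable $k$-partition of a graph $G$ is a multiset $P=\{V_1,\dots,V_k\}$ of $k$ independent sets of $G$ (some possibly empty) that partition $V(G)$. For $v\in V(G)$, $P-v$ denotes the multiset $\{V_i\setminus\{v\}:1\le i\le k\}$. The Bell $k$-coloring graph $\mathcal{B}_k(G)$ has as vertices all stable $k$-partitions of $G$, and two distinct partitions $P,Q$ are adjacent if and only if $P-v=Q-v$ for some $v\in V(G)$. -}

module Defs where

open import Data.Nat using (ℕ; suc)
open import Data.Fin using (Fin; zero; suc)
open import Data.Bool using (Bool; true; false)
open import Data.Fin.Permutation using (Permutation′; _⟨$⟩ʳ_)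
open import Data.Product using (Σ; ∃; _×_; _,_)
open import Relation.Binary.PropositionalEquality using (_≡_; _≢_)
open import Relation.Nullary using (¬_)
open import Function.Bundles using (_⇔_)

record Graph : Set where
  field
    n     : ℕ
    adj   : Fin n → Fin n → Bool
    sym   : ∀ u v → adj u v ≡ adj v u
    irrefl : ∀ v → adj v v ≡ false
open Graph public

-- A stable k-partition {V_1,…,V_k} of G, encoded by the map c : V(G) → Fin k
-- sending v to the index i with v ∈ V_i (so V_i = c⁻¹(i), possibly empty).
-- Stability: each V_i is independent.
record StablePartition (G : Graph) (k : ℕ) : Set where
  field
    part   : Fin (n G) → Fin k
    stable : ∀ u v → adj G u v ≡ true → part u ≢ part v
open StablePartition public

-- Equality of P and Q as multisets {V_i} = {W_i}:
-- some permutation σ of the indices with V_i = W_{σ i}.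
_≈ₚ_ : ∀ {G k} → StablePartition G k → StablePartition G k → Set
_≈ₚ_ {G} {k} P Q =
  Σ (Permutation′ k) λ σ → ∀ v → part Q v ≡ σ ⟨$⟩ʳ part P v

-- P - v = Q - v as multisets {V_i ∖ {v}} = {W_i ∖ {v}}.
MinusEq : ∀ {G k} → StablePartition G k → StablePartition G k → Fin (n G) → Set
MinusEq {G} {k} P Q v =
  Σ (Permutation′ k) λ σ → ∀ u → u ≢ v → part Q u ≡ σ ⟨$⟩ʳ part P u

BellAdj : ∀ {G k} → StablePartition G k → StablePartition G k → Set
BellAdj {G} P Q = ¬ (P ≈ₚ Q) × ∃ λ v → MinusEq P Q v

-- The diamond K_4 - e on Fin 4, with the missing edge {0,3}.
diamondAdj : Fin 4 → Fin 4 → Bool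
diamondAdj zero zero = false
diamondAdj zero (suc (suc (suc zero))) = false
diamondAdj zero _ = true
diamondAdj (suc (suc (suc zero))) zero = false
diamondAdj (suc (suc (suc zero))) (suc (suc (suc zero))) = false
diamondAdj (suc (suc (suc zero))) _ = true
diamondAdj (suc zero) (suc zero) = false
diamondAdj (suc zero) _ = true
diamondAdj (suc (suc zero)) (suc (suc zero)) = false
diamondAdj (suc (suc zero)) _ = true

-- K_4 - e is isomorphic to B_k(G): a bijection φ from Fin 4 onto the vertices
-- of B_k(G) (which are partitions up to multiset equality ≈ₚ) preserving and
-- reflecting adjacency.
DiamondIsoBell : (G : Graph) (k : ℕ) → Set
DiamondIsoBell G k =
  Σ (Fin 4 → StablePartition G k) λ φ →
    (∀ i j → φ i ≈ₚ φ j → i ≡ j) ×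
    (∀ (P : StablePartition G k) → ∃ λ i → P ≈ₚ φ i) ×
    (∀ i j → (diamondAdj i j ≡ true) ⇔ BellAdj (φ i) (φ j))

{-# OPTIONS --safe #-}
module Submission where

-- Partitions are compared through their same-block relations; P ≃ Q ∖ t says P - t = Q - t.
-- Let X, Y, Z be pairwise adjacent in the Bell graph, with X - u = Z - u and Y - y = Z - y.
-- Unless X - t = Y - t = Z - t for a single t, Y and Z disagree on whether u and y share a
-- block, so uy is not an edge of G and gluing X - y to Y - u yields a partition adjacent to X
-- and distinct from X, Y, Z. In the diamond the non-adjacent vertices A and D have closed
-- neighbourhoods {A, B, C} and {D, B, C}, so both triangles have common vertices x and z.
-- Then B and C agree off x and off z, which forces x ≠ z to be non-adjacent in G (otherwise
-- B = C), and gluing A - z to D - x yields a fifth partition.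

open import Defs hiding (sym)
open import Data.Nat using (ℕ; suc)

open import Data.Bool using (Bool; true; false)
import Data.Bool.Properties as Bool
open import Data.Fin using (Fin; _≟_)
open import Data.Fin.Patterns using (0F; 1F; 2F; 3F)
open import Data.Fin.Permutation using (Permutation′; _⟨$⟩ʳ_; _⟨$⟩ˡ_; _∘ₚ_; id; transpose)
import Data.Fin.Permutation.Components as PC
open import Data.List using (List; []; _∷_; allFin)
open import Data.List.Membership.Propositional using (_∈_)
open import Data.List.Membership.Propositional.Properties using (∈-allFin)
open import Data.List.Relation.Unary.Any using (here; there)
open import Data.Product using (Σ; ∃-syntax; _×_; _,_; proj₁; proj₂; map₂)
open import Data.Sum using (_⊎_; inj₁; inj₂; [_,_]′)
open import Data.Unit using (⊤; tt)
open import Data.Vec.Functional using (updateAt)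
open import Data.Vec.Functional.Properties using (updateAt-updates; updateAt-minimal)
open import Function using (_∘_; const)
open import Function.Bundles using (Inverse; Injection; Equivalence; _⇔_; mk⇔)
open import Function.Properties.Inverse using (↔⇒↣)
open import Relation.Binary.PropositionalEquality
  using (_≡_; _≢_; refl; sym; trans; cong; cong₂; subst₂; _≗_; module ≡-Reasoning)
open import Relation.Nullary using (¬_; Dec; yes; no; does; contradiction; ¬?; _×-dec_)
open import Relation.Nullary.Decidable using (dec-true; dec-false; does-⇔)
open import Relation.Unary using (Pred; Decidable; _⊆_)

transpose-hit : ∀ {K} (i j : Fin K) → PC.transpose i j i ≡ j
transpose-hit i j rewrite dec-true (i ≟ i) refl = refl

transpose-fix : ∀ {K} {i j k : Fin K} → k ≢ i → k ≢ j → PC.transpose i j k ≡ k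
transpose-fix {i = i} {j} {k} k≢i k≢j
  rewrite dec-false (k ≟ i) k≢i | dec-false (k ≟ j) k≢j = refl

does-≡⇒⇔ : ∀ {a b} {A : Set a} {B : Set b} (a? : Dec A) (b? : Dec B) →
           does a? ≡ does b? → A ⇔ B
does-≡⇒⇔ a? b? e = mk⇔ (transport a? b? e) (transport b? a? (sym e))
  where
  transport : ∀ {c d} {C : Set c} {D : Set d} (c? : Dec C) (d? : Dec D) → does c? ≡ does d? → C → D
  transport c? (yes d) _ _ = d
  transport c? (no ¬d) e c = contradiction (trans (sym (dec-true c? c)) e) λ ()

module _ {m K : ℕ} where

  Relabelling : Pred (Fin m) _ → (Fin m → Fin K) → (Fin m → Fin K) → Set
  Relabelling D f g = Σ (Permutation′ K) λ σ → ∀ a → D a → g a ≡ σ ⟨$⟩ʳ f a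

  SameKernelOn : Pred (Fin m) _ → (Fin m → Fin K) → (Fin m → Fin K) → Set
  SameKernelOn D f g = ∀ {a b} → D a → D b → f a ≡ f b ⇔ g a ≡ g b

  relabelling⇒sameKernel : ∀ {D f g} → Relabelling D f g → SameKernelOn D f g
  relabelling⇒sameKernel (σ , σ-ok) {a} {b} Da Db = mk⇔
    (λ fa≡fb → trans (σ-ok a Da) (trans (cong (σ ⟨$⟩ʳ_) fa≡fb) (sym (σ-ok b Db))))
    (λ ga≡gb → Injection.injective (↔⇒↣ σ) (trans (sym (σ-ok a Da)) (trans ga≡gb (σ-ok b Db))))

  module _ {D : Pred (Fin m) _} (D? : Decidable D) {f g : Fin m → Fin K}
           (kernel : SameKernelOn D f g) where

    private
      RelabelsAll : Permutation′ K → List (Fin m) → Set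
      RelabelsAll σ as = ∀ {a} → a ∈ as → D a → g a ≡ σ ⟨$⟩ʳ f a

      relabelling-of : ∀ as → Σ (Permutation′ K) λ σ → RelabelsAll σ as
      relabelling-of [] = id , λ ()
      relabelling-of (a ∷ as) with relabelling-of as | D? a
      ... | σ , σ-ok | no ¬Da = σ , λ { (here refl) Da → contradiction Da ¬Da
                                       ; (there b∈as) → σ-ok b∈as }
      ... | σ , σ-ok | yes Da = σ ∘ₚ transpose (σ ⟨$⟩ʳ f a) (g a) , extended
        where
        τ : Fin K → Fin K
        τ = PC.transpose (σ ⟨$⟩ʳ f a) (g a)

        extended : RelabelsAll (σ ∘ₚ transpose (σ ⟨$⟩ʳ f a) (g a)) (a ∷ as)
        extended (here refl) _ = sym (transpose-hit (σ ⟨$⟩ʳ f a) (g a))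
        extended {b} (there b∈as) Db with f b ≟ f a
        ... | yes fb≡fa = begin
          g b             ≡⟨ Equivalence.to (kernel Db Da) fb≡fa ⟩
          g a             ≡⟨ sym (transpose-hit (σ ⟨$⟩ʳ f a) (g a)) ⟩
          τ (σ ⟨$⟩ʳ f a)  ≡⟨ cong (τ ∘ (σ ⟨$⟩ʳ_)) (sym fb≡fa) ⟩
          τ (σ ⟨$⟩ʳ f b)  ∎
          where open ≡-Reasoning
        ... | no fb≢fa = trans (σ-ok b∈as Db) (sym (transpose-fix σfb≢σfa σfb≢ga))
          where
          σfb≢σfa : σ ⟨$⟩ʳ f b ≢ σ ⟨$⟩ʳ f a
          σfb≢σfa = fb≢fa ∘ Injection.injective (↔⇒↣ σ)

          σfb≢ga : σ ⟨$⟩ʳ f b ≢ g a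
          σfb≢ga e = fb≢fa (Equivalence.from (kernel Db Da) (trans (σ-ok b∈as Db) e))

    sameKernel⇒relabelling : Relabelling D f g
    sameKernel⇒relabelling =
      let σ , σ-ok = relabelling-of (allFin m) in σ , λ a → σ-ok (∈-allFin a)

module _ {G : Graph} {K : ℕ} where

  private
    V : Set
    V = Fin (n G)

    Partition : Set
    Partition = StablePartition G K

  sameBlock : Partition → V → V → Bool
  sameBlock P a b = does (part P a ≟ part P b)

  sameBlock-refl : ∀ P a → sameBlock P a a ≡ true
  sameBlock-refl P a = dec-true (part P a ≟ part P a) refl

  sameBlock-sym : ∀ P a b → sameBlock P a b ≡ sameBlock P b a
  sameBlock-sym P a b = does-⇔ (mk⇔ sym sym) (part P a ≟ part P b) (part P b ≟ part P a)

  sameBlock-edge : ∀ P {a b} → adj G a b ≡ true → sameBlock P a b ≡ false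
  sameBlock-edge P {a} {b} e = dec-false (part P a ≟ part P b) (stable P a b e)

  record AgreeOn (U : Pred V _) (P Q : Partition) : Set where
    constructor agreeOn
    field agree : ∀ {a b} → U a → U b → sameBlock P a b ≡ sameBlock Q a b
  open AgreeOn public

  _≃_ : Partition → Partition → Set
  P ≃ Q = AgreeOn (λ _ → ⊤) P Q

  _≃_∖_ : Partition → Partition → V → Set
  P ≃ Q ∖ t = AgreeOn (_≢ t) P Q

  _≃_∖_∖_ : Partition → Partition → V → V → Set
  P ≃ Q ∖ s ∖ t = AgreeOn (λ a → a ≢ s × a ≢ t) P Q

  -- P ∼ Q: P and Q are equal or adjacent in the Bell colouring graph.
  _∼_ : Partition → Partition → Set
  P ∼ Q = ∃[ t ] P ≃ Q ∖ t

  infix 4 _≃_ _≃_∖_ _≃_∖_∖_ _∼_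

  agreeOn-sym : ∀ {U P Q} → AgreeOn U P Q → AgreeOn U Q P
  agreeOn-sym P≃Q = agreeOn λ Ua Ub → sym (agree P≃Q Ua Ub)

  agreeOn-trans : ∀ {U P Q R} → AgreeOn U P Q → AgreeOn U Q R → AgreeOn U P R
  agreeOn-trans P≃Q Q≃R = agreeOn λ Ua Ub → trans (agree P≃Q Ua Ub) (agree Q≃R Ua Ub)

  agreeOn-mono : ∀ {U W P Q} → U ⊆ W → AgreeOn W P Q → AgreeOn U P Q
  agreeOn-mono U⊆W P≃Q = agreeOn λ Ua Ub → agree P≃Q (U⊆W Ua) (U⊆W Ub)

  ≃⇒≃∖ : ∀ {P Q t} → P ≃ Q → P ≃ Q ∖ t
  ≃⇒≃∖ = agreeOn-mono (const tt)

  ≃∖-trans₂ : ∀ {P Q R s t} → P ≃ Q ∖ s → Q ≃ R ∖ t → P ≃ R ∖ s ∖ t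
  ≃∖-trans₂ P≃Q Q≃R = agreeOn-trans (agreeOn-mono proj₁ P≃Q) (agreeOn-mono proj₂ Q≃R)

  agreeOn-pivot : ∀ {U P Q} a → AgreeOn (λ c → U c × c ≢ a) P Q →
                  (∀ {d} → U d → sameBlock P a d ≡ sameBlock Q a d) → AgreeOn U P Q
  agreeOn-pivot {U} {P} {Q} a P≃Q pivot = agreeOn agreeAt
    where
    agreeAt : ∀ {c d} → U c → U d → sameBlock P c d ≡ sameBlock Q c d
    agreeAt {c} {d} Uc Ud with c ≟ a | d ≟ a
    ... | yes refl | _        = pivot Ud
    ... | no _     | yes refl = trans (sameBlock-sym P c a) (trans (pivot Uc) (sameBlock-sym Q a c))
    ... | no c≢a   | no d≢a   = agree P≃Q (Uc , c≢a) (Ud , d≢a)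

  ≃∖-row : ∀ {P Q a w} → P ≃ Q ∖ w → a ≢ w → sameBlock P a w ≡ sameBlock Q a w →
           sameBlock P a ≗ sameBlock Q a
  ≃∖-row {w = w} P≃Q a≢w same d with d ≟ w
  ... | yes refl = same
  ... | no d≢w   = agree P≃Q a≢w d≢w

  ≃∖-move : ∀ {P Q a t w} → P ≃ Q ∖ w → P ≃ Q ∖ t ∖ a → a ≢ w →
            sameBlock P a w ≡ sameBlock Q a w → P ≃ Q ∖ t
  ≃∖-move {a = a} P≃Q∖w P≃Q∖t∖a a≢w same =
    agreeOn-pivot a P≃Q∖t∖a (λ {d} _ → ≃∖-row P≃Q∖w a≢w same d)

  ≃∖-edge⇒≃ : ∀ {P Q x z} → adj G x z ≡ true → x ≢ z → P ≃ Q ∖ x → P ≃ Q ∖ z → P ≃ Q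
  ≃∖-edge⇒≃ {P} {Q} {x} e x≢z P≃Q∖x P≃Q∖z =
    agreeOn-pivot x (agreeOn-mono proj₂ P≃Q∖x)
      (λ {d} _ → ≃∖-row P≃Q∖z x≢z (trans (sameBlock-edge P e) (sym (sameBlock-edge Q e))) d)

  relabelling⇒agreeOn : ∀ {U P Q} → Relabelling U (part P) (part Q) → AgreeOn U P Q
  relabelling⇒agreeOn {P = P} {Q} ρ = agreeOn λ {a} {b} Ua Ub →
    does-⇔ (relabelling⇒sameKernel ρ Ua Ub) (part P a ≟ part P b) (part Q a ≟ part Q b)

  agreeOn⇒relabelling : ∀ {U P Q} → Decidable U → AgreeOn U P Q → Relabelling U (part P) (part Q)
  agreeOn⇒relabelling {P = P} {Q} U? P≃Q = sameKernel⇒relabelling U?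
    (λ {a} {b} Ua Ub → does-≡⇒⇔ (part P a ≟ part P b) (part Q a ≟ part Q b) (agree P≃Q Ua Ub))

  ≈ₚ⇒≃ : ∀ {P Q} → P ≈ₚ Q → P ≃ Q
  ≈ₚ⇒≃ (σ , σ-ok) = relabelling⇒agreeOn (σ , λ a _ → σ-ok a)

  ≃⇒≈ₚ : ∀ {P Q} → P ≃ Q → P ≈ₚ Q
  ≃⇒≈ₚ P≃Q = let σ , σ-ok = agreeOn⇒relabelling (λ _ → yes tt) P≃Q in σ , λ a → σ-ok a tt

  MinusEq⇒≃∖ : ∀ {P Q t} → MinusEq P Q t → P ≃ Q ∖ t
  MinusEq⇒≃∖ = relabelling⇒agreeOn

  ≃∖⇒MinusEq : ∀ {P Q t} → P ≃ Q ∖ t → MinusEq P Q t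
  ≃∖⇒MinusEq {t = t} = agreeOn⇒relabelling (λ a → ¬? (a ≟ t))

  recolour : (P : Partition) (t : V) (c : Fin K) → (∀ {w} → adj G t w ≡ true → part P w ≢ c) →
             Partition
  part (recolour P t c free) = updateAt (part P) t (const c)
  stable (recolour P t c free) a b e with a ≟ t | b ≟ t
  ... | yes refl | yes refl = contradiction (trans (sym e) (irrefl G t)) λ ()
  ... | yes refl | no b≢t   = subst₂ _≢_
    (sym (updateAt-updates t (part P))) (sym (updateAt-minimal b t (part P) b≢t)) (free e ∘ sym)
  ... | no a≢t   | yes refl = subst₂ _≢_
    (sym (updateAt-minimal a t (part P) a≢t)) (sym (updateAt-updates t (part P)))
    (free (trans (Graph.sym G t a) e))
  ... | no a≢t   | no b≢t   = subst₂ _≢_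
    (sym (updateAt-minimal a t (part P) a≢t)) (sym (updateAt-minimal b t (part P) b≢t))
    (stable P a b e)

  module _ {P : Partition} {t : V} {c : Fin K}
           (free : ∀ {w} → adj G t w ≡ true → part P w ≢ c) where

    recolour-≃∖ : recolour P t c free ≃ P ∖ t
    recolour-≃∖ = agreeOn λ {a} {b} a≢t b≢t → cong₂ (λ x y → does (x ≟ y))
      (updateAt-minimal a t (part P) a≢t) (updateAt-minimal b t (part P) b≢t)

    sameBlock-recolour : ∀ {d} → d ≢ t → sameBlock (recolour P t c free) t d ≡ does (c ≟ part P d)
    sameBlock-recolour {d} d≢t = cong₂ (λ x y → does (x ≟ y))
      (updateAt-updates t (part P)) (updateAt-minimal d t (part P) d≢t)

  glue : ∀ {P Q a b} → adj G a b ≢ true → P ≃ Q ∖ a ∖ b → ∃[ R ] ((R ≃ P ∖ b) × (R ≃ Q ∖ a))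
  glue {P} {Q} {a} {b} a≁b P≃Q = R , R≃P , R≃Q
    where
    relabelling : Relabelling (λ w → w ≢ a × w ≢ b) (part P) (part Q)
    relabelling = agreeOn⇒relabelling (λ w → ¬? (w ≟ a) ×-dec ¬? (w ≟ b)) P≃Q

    σ : Permutation′ K
    σ = proj₁ relabelling

    σ-ok : ∀ {w} → w ≢ a → w ≢ b → part Q w ≡ σ ⟨$⟩ʳ part P w
    σ-ok w≢a w≢b = proj₂ relabelling _ (w≢a , w≢b)

    colour : Fin K
    colour = σ ⟨$⟩ˡ part Q b

    free : ∀ {w} → adj G b w ≡ true → part P w ≢ colour
    free {w} e Pw≡colour with w ≟ a | w ≟ b
    ... | yes refl | _        = a≁b (trans (Graph.sym G w b) e)
    ... | no _     | yes refl = contradiction (trans (sym e) (irrefl G w)) λ ()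
    ... | no w≢a   | no w≢b   =
      stable Q b w e (sym (trans (σ-ok w≢a w≢b) (Inverse.inverseˡ σ Pw≡colour)))

    R : Partition
    R = recolour P b colour free

    R≃P : R ≃ P ∖ b
    R≃P = recolour-≃∖ free

    colour-kernel : ∀ {d} → d ≢ a → d ≢ b → colour ≡ part P d ⇔ part Q b ≡ part Q d
    colour-kernel d≢a d≢b = mk⇔
      (λ colour≡Pd → sym (trans (σ-ok d≢a d≢b) (Inverse.inverseˡ σ (sym colour≡Pd))))
      (λ Qb≡Qd → Inverse.inverseʳ σ (trans Qb≡Qd (σ-ok d≢a d≢b)))

    pivot : ∀ {d} → d ≢ a → sameBlock R b d ≡ sameBlock Q b d
    pivot {d} d≢a with d ≟ b
    ... | yes refl = trans (sameBlock-refl R d) (sym (sameBlock-refl Q d))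
    ... | no d≢b   = trans (sameBlock-recolour {P} free d≢b)
      (does-⇔ (colour-kernel d≢a d≢b) (colour ≟ part P d) (part Q b ≟ part Q d))

    R≃Q : R ≃ Q ∖ a
    R≃Q = agreeOn-pivot b (agreeOn-trans (agreeOn-mono proj₂ R≃P) P≃Q) pivot

  triangle-common-vertex : ∀ {X Y Z} → X ∼ Y → Y ∼ Z → X ∼ Z →
                           (∀ {R} → R ∼ X → R ≃ X ⊎ R ≃ Y ⊎ R ≃ Z) →
                           ∃[ t ] ((X ≃ Y ∖ t) × (X ≃ Z ∖ t))
  triangle-common-vertex {X} {Y} {Z} (v , X≃Y∖v) (y , Y≃Z∖y) (u , X≃Z∖u) closed with u ≟ y
  ... | yes refl = u , agreeOn-trans X≃Z∖u (agreeOn-sym Y≃Z∖y) , X≃Z∖u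
  ... | no u≢y with sameBlock Y u y Bool.≟ sameBlock Z u y
  ...   | yes same = v , X≃Y∖v , agreeOn-trans X≃Y∖v Y≃Z∖v
    where
    Y≃Z∖v : Y ≃ Z ∖ v
    Y≃Z∖v = ≃∖-move Y≃Z∖y (≃∖-trans₂ (agreeOn-sym X≃Y∖v) X≃Z∖u) u≢y same
  ...   | no differ with glue u≁y (≃∖-trans₂ X≃Z∖u (agreeOn-sym Y≃Z∖y))
    where
    u≁y : adj G u y ≢ true
    u≁y e = differ (trans (sameBlock-edge Y e) (sym (sameBlock-edge Z e)))
  ...     | R , R≃X∖y , R≃Y∖u with closed (y , R≃X∖y)
  ...       | inj₁ R≃X = u , agreeOn-trans (agreeOn-sym (≃⇒≃∖ R≃X)) R≃Y∖u , X≃Z∖u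
  ...       | inj₂ (inj₁ R≃Y) = y , X≃Y∖y , agreeOn-trans X≃Y∖y Y≃Z∖y
    where
    X≃Y∖y : X ≃ Y ∖ y
    X≃Y∖y = agreeOn-trans (agreeOn-sym R≃X∖y) (≃⇒≃∖ R≃Y)
  ...       | inj₂ (inj₂ R≃Z) = y , agreeOn-trans X≃Z∖y (agreeOn-sym Y≃Z∖y) , X≃Z∖y
    where
    X≃Z∖y : X ≃ Z ∖ y
    X≃Z∖y = agreeOn-trans (agreeOn-sym R≃X∖y) (≃⇒≃∖ R≃Z)

  fifth-partition : ∀ {A B C D x z} → ¬ A ∼ D → ¬ B ≃ C →
                    A ≃ B ∖ x → A ≃ C ∖ x → D ≃ B ∖ z → D ≃ C ∖ z →
                    ∃[ R ] (¬ R ≃ A × ¬ R ≃ B × ¬ R ≃ C × ¬ R ≃ D)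
  fifth-partition {A} {B} {C} {D} {x} {z} A≁D B≄C A≃B∖x A≃C∖x D≃B∖z D≃C∖z
    with glue x≁z (≃∖-trans₂ A≃B∖x (agreeOn-sym D≃B∖z))
    where
    x≢z : x ≢ z
    x≢z refl = A≁D (x , agreeOn-trans A≃B∖x (agreeOn-sym D≃B∖z))

    x≁z : adj G x z ≢ true
    x≁z e = B≄C (≃∖-edge⇒≃ e x≢z
      (agreeOn-trans (agreeOn-sym A≃B∖x) A≃C∖x) (agreeOn-trans (agreeOn-sym D≃B∖z) D≃C∖z))
  ... | R , R≃A∖z , R≃D∖x = R , R≄A , R≄B , R≄C , R≄D
    where
    A∼D-via : ∀ {S} → R ≃ S → S ≃ D ∖ z → A ∼ D
    A∼D-via R≃S S≃D = z , agreeOn-trans (agreeOn-sym R≃A∖z) (agreeOn-trans (≃⇒≃∖ R≃S) S≃D)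

    R≄A : ¬ R ≃ A
    R≄A R≃A = A≁D (x , agreeOn-trans (agreeOn-sym (≃⇒≃∖ R≃A)) R≃D∖x)
    R≄B : ¬ R ≃ B
    R≄B R≃B = A≁D (A∼D-via R≃B (agreeOn-sym D≃B∖z))
    R≄C : ¬ R ≃ C
    R≄C R≃C = A≁D (A∼D-via R≃C (agreeOn-sym D≃C∖z))
    R≄D : ¬ R ≃ D
    R≄D R≃D = A≁D (z , agreeOn-trans (agreeOn-sym R≃A∖z) (≃⇒≃∖ R≃D))

module Diamond {G : Graph} {K : ℕ} (iso : DiamondIsoBell G K) where

  φ : Fin 4 → StablePartition G K
  φ = proj₁ iso

  A B C D : StablePartition G K
  A = φ 0F
  B = φ 1F
  C = φ 2F
  D = φ 3F

  φ-distinct : ∀ {i j} → i ≢ j → ¬ φ i ≃ φ j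
  φ-distinct i≢j = i≢j ∘ proj₁ (proj₂ iso) _ _ ∘ ≃⇒≈ₚ

  φ-edge : ∀ i j → diamondAdj i j ≡ true → φ i ∼ φ j
  φ-edge i j e = map₂ MinusEq⇒≃∖ (proj₂ (Equivalence.to (proj₂ (proj₂ (proj₂ iso)) i j) e))

  A≁D : ¬ A ∼ D
  A≁D (t , A≃D∖t)
    with Equivalence.from (proj₂ (proj₂ (proj₂ iso)) 0F 3F)
           (φ-distinct (λ ()) ∘ ≈ₚ⇒≃ , t , ≃∖⇒MinusEq A≃D∖t)
  ... | ()

  one-of-four : ∀ R → R ≃ A ⊎ R ≃ B ⊎ R ≃ C ⊎ R ≃ D
  one-of-four R with proj₁ (proj₂ (proj₂ iso)) R
  ... | 0F , R≈A = inj₁ (≈ₚ⇒≃ R≈A)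
  ... | 1F , R≈B = inj₂ (inj₁ (≈ₚ⇒≃ R≈B))
  ... | 2F , R≈C = inj₂ (inj₂ (inj₁ (≈ₚ⇒≃ R≈C)))
  ... | 3F , R≈D = inj₂ (inj₂ (inj₂ (≈ₚ⇒≃ R≈D)))

  closed-at-A : ∀ {R} → R ∼ A → R ≃ A ⊎ R ≃ B ⊎ R ≃ C
  closed-at-A {R} (t , R≃A∖t) with one-of-four R
  ... | inj₁ R≃A               = inj₁ R≃A
  ... | inj₂ (inj₁ R≃B)        = inj₂ (inj₁ R≃B)
  ... | inj₂ (inj₂ (inj₁ R≃C)) = inj₂ (inj₂ R≃C)
  ... | inj₂ (inj₂ (inj₂ R≃D)) =
    contradiction (t , agreeOn-trans (agreeOn-sym R≃A∖t) (≃⇒≃∖ R≃D)) A≁D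

  closed-at-D : ∀ {R} → R ∼ D → R ≃ D ⊎ R ≃ B ⊎ R ≃ C
  closed-at-D {R} (t , R≃D∖t) with one-of-four R
  ... | inj₁ R≃A =
    contradiction (t , agreeOn-trans (agreeOn-sym (≃⇒≃∖ R≃A)) R≃D∖t) A≁D
  ... | inj₂ (inj₁ R≃B)        = inj₂ (inj₁ R≃B)
  ... | inj₂ (inj₂ (inj₁ R≃C)) = inj₂ (inj₂ R≃C)
  ... | inj₂ (inj₂ (inj₂ R≃D)) = inj₁ R≃D

theorem3p9 : (G : Graph) (k : ℕ) → ¬ DiamondIsoBell G (suc k)
theorem3p9 G k iso =
  let open Diamond iso
      x , A≃B∖x , A≃C∖x = triangle-common-vertex
                            (φ-edge 0F 1F refl) (φ-edge 1F 2F refl) (φ-edge 0F 2F refl) closed-at-A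
      z , D≃B∖z , D≃C∖z = triangle-common-vertex
                            (φ-edge 3F 1F refl) (φ-edge 1F 2F refl) (φ-edge 3F 2F refl) closed-at-D
      R , R≄A , R≄B , R≄C , R≄D = fifth-partition A≁D (φ-distinct λ ()) A≃B∖x A≃C∖x D≃B∖z D≃C∖z
  in  [ R≄A , [ R≄B , [ R≄C , R≄D ]′ ]′ ]′ (one-of-four R)
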